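{- Let $m\ge n\ge 1$ be integers and let $S_{n,m}$ be the bistar. Then $\mu_2(S_{n,m})=m+1$ and $\mu_3(S_{n,m})=n+m$.
   Context: The bistar $S_{n,m}$ is the tree obtained from an edge $xy$ by attaching $m$ pendant vertices (leaves) to $x$ and $n$ pendant vertices to $y$ (so $d(x)=m+1$, $d(y)=n+1$, and the diameter is $3$). For a graph $G$, a set $S\subseteq V(G)$ and an integer $k\ge 1$, two vertices $x,y$ are $S_k$-visible if there is a shortest $x,y$-path of length at most $k$ none of whose internal vertices lies in $S$. $S$ is a $k$-distance mutual-visibility set if every two vertices of $S$ are $S_k$-visible, and $\mu_k(G)$ is the maximum cardinality of such a set. -}

module Defs where

open import Data.Nat using (ℕ; zero; suc; _+_; _≤_; _<_)
open import Data.Fin using (Fin; toℕ)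
open import Data.Fin.Subset using (Subset; _∈_; _∉_; ∣_∣)
open import Data.List using (List; []; _∷_)
open import Data.List.Relation.Unary.All using (All)
open import Data.Product using (Σ; ∃; _×_; _,_)
open import Data.Sum using (_⊎_)
open import Relation.Binary.PropositionalEquality using (_≡_)

Graph : ℕ → Set₁
Graph N = Fin N → Fin N → Set

data Walk {N : ℕ} (G : Graph N) : Fin N → Fin N → ℕ → Set where
  nil  : ∀ {u} → Walk G u u 0
  cons : ∀ {u v w ℓ} → G u v → Walk G v w ℓ → Walk G u w (suc ℓ)

internal : ∀ {N} {G : Graph N} {u v ℓ} → Walk G u v ℓ → List (Fin N)
internal nil = []
internal (cons e nil) = []
internal (cons {v = v} e (cons e' w)) = v ∷ internal (cons e' w)

-- A shortest u,v-walk: no u,v-walk is shorter (such a walk is a shortest path).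
IsShortest : ∀ {N} (G : Graph N) {u v ℓ} → Walk G u v ℓ → Set
IsShortest G {u} {v} {ℓ} _ = ∀ ℓ' → Walk G u v ℓ' → ℓ ≤ ℓ'

Visible : ∀ {N} (G : Graph N) (S : Subset N) (k : ℕ) (u v : Fin N) → Set
Visible G S k u v =
  Σ ℕ λ ℓ → Σ (Walk G u v ℓ) λ w →
    IsShortest G w × ℓ ≤ k × All (λ z → z ∉ S) (internal w)

IsKDMV : ∀ {N} (G : Graph N) (k : ℕ) (S : Subset N) → Set
IsKDMV G k S = ∀ u v → u ∈ S → v ∈ S → Visible G S k u v

IsMu : ∀ {N} (G : Graph N) (k : ℕ) (r : ℕ) → Set
IsMu G k r = (Σ (Subset _) λ S → IsKDMV G k S × ∣ S ∣ ≡ r)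
           × (∀ S → IsKDMV G k S → ∣ S ∣ ≤ r)

-- Bistar S_{n,m} on Fin (2 + m + n): vertex 0 is x, vertex 1 is y,
-- vertices 2 .. m+1 are the m leaves at x, vertices m+2 .. m+n+1 the n leaves at y.
BistarAdj₀ : (n m : ℕ) → Fin (2 + m + n) → Fin (2 + m + n) → Set
BistarAdj₀ n m i j =
    (toℕ i ≡ 0 × toℕ j ≡ 1)
  ⊎ (toℕ i ≡ 0 × (2 ≤ toℕ j × toℕ j < 2 + m))
  ⊎ (toℕ i ≡ 1 × 2 + m ≤ toℕ j)

Bistar : (n m : ℕ) → Graph (2 + m + n)
Bistar n m i j = BistarAdj₀ n m i j ⊎ BistarAdj₀ n m j i

{-# OPTIONS --safe #-}
module Submission where

-- A leaf whose support vertex lies in S is visible from no vertex other than its support. So if S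
-- contains x and a leaf at x, it contains nothing of the star around y, and symmetrically; otherwise
-- the part of S in each star is at most the number of its leaves. Either way |S| ≤ n + m for every k.
-- For k = 2 a leaf at x and a leaf at y are at distance 3, so S has leaves on one side only, which
-- improves the bound to m + 1. All leaves (k = 3), and y with the leaves at x (k = 2), attain the bounds.

open import Defs
open import Data.Nat using (ℕ; zero; suc; _+_; _≤_; _<_; z≤n; s≤s; s≤s⁻¹)
open import Data.Nat.Properties using (+-suc; n≤1+n; ≤-refl; ≤-reflexive; ≤-trans; <⇒≱; m≤m+n; +-comm; +-identityʳ; +-mono-≤; +-monoˡ-≤; module ≤-Reasoning)
open import Data.Fin using (Fin; zero; suc; toℕ; _↑ˡ_; _↑ʳ_; _≟_)
import Data.Fin as Fin
open import Data.Fin.Properties using (toℕ-injective; toℕ-↑ˡ; toℕ-↑ʳ; toℕ<n; suc-injective; splitAt-↑ˡ; splitAt-↑ʳ; splitAt⁻¹-↑ˡ; splitAt⁻¹-↑ʳ)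
open import Data.Fin.Subset using (Subset; inside; outside; _∈_; _∉_; ∣_∣; ⊤; ⊥; Empty)
open import Data.Fin.Subset.Properties using (∣p∣≤n; ∣⊤∣≡n; ∣⊥∣≡0; ∉⊥; Empty-unique; nonempty?; drop-there)
open import Data.Vec using ([]; _∷_; _++_; take; drop; here; there)
open import Data.Vec.Properties using (take++drop≡id; lookup-++ˡ; lookup-++ʳ; []=⇒lookup; lookup⇒[]=)
open import Data.List.Relation.Unary.All using ([]; _∷_)
open import Data.Product using (∃; ∃₂; _×_; _,_)
open import Data.Sum using (_⊎_; inj₁; inj₂; [_,_]′; swap)
open import Function using (_∘′_; id; case_of_)
open import Data.Empty using (⊥-elim)
open import Relation.Nullary using (¬_; yes; no)
open import Relation.Binary.PropositionalEquality

module Subsets where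

  ∣p++q∣≡∣p∣+∣q∣ : ∀ {a b} (p : Subset a) (q : Subset b) → ∣ p ++ q ∣ ≡ ∣ p ∣ + ∣ q ∣
  ∣p++q∣≡∣p∣+∣q∣ []            q = refl
  ∣p++q∣≡∣p∣+∣q∣ (inside ∷ p)  q = cong suc (∣p++q∣≡∣p∣+∣q∣ p q)
  ∣p++q∣≡∣p∣+∣q∣ (outside ∷ p) q = ∣p++q∣≡∣p∣+∣q∣ p q

  ∈-++⁺ˡ : ∀ {a b} {p : Subset a} (q : Subset b) {i} → i ∈ p → i ↑ˡ b ∈ p ++ q
  ∈-++⁺ˡ {p = p} q {i} i∈p = lookup⇒[]= _ (p ++ q) (trans (lookup-++ˡ p q i) ([]=⇒lookup i∈p))

  ∈-++⁺ʳ : ∀ {a b} (p : Subset a) {q : Subset b} {i} → i ∈ q → a ↑ʳ i ∈ p ++ q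
  ∈-++⁺ʳ {a} p {q} {i} i∈q = lookup⇒[]= _ (p ++ q) (trans (lookup-++ʳ p q i) ([]=⇒lookup i∈q))

  ∈-++⁻ʳ : ∀ {a b} (p : Subset a) {q : Subset b} {i} → a ↑ʳ i ∈ p ++ q → i ∈ q
  ∈-++⁻ʳ {a} p {q} {i} i∈p++q = lookup⇒[]= i q (trans (sym (lookup-++ʳ p q i)) ([]=⇒lookup i∈p++q))

  Empty⇒∣p∣≡0 : ∀ {a} {p : Subset a} → Empty p → ∣ p ∣ ≡ 0
  Empty⇒∣p∣≡0 {a} ∅ rewrite Empty-unique ∅ = ∣⊥∣≡0 a

  -- A subset of Fin (suc k) is read as a set of vertices of a star with centre zero.
  HasLeaf : ∀ {k} → Subset (suc k) → Set
  HasLeaf X = ∃ λ j → suc j ∈ X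

  HasCentreAndLeaf : ∀ {k} → Subset (suc k) → Set
  HasCentreAndLeaf X = zero ∈ X × HasLeaf X

  hasLeaf⊎∣X∣≤1 : ∀ {k} (X : Subset (suc k)) → HasLeaf X ⊎ ∣ X ∣ ≤ 1
  hasLeaf⊎∣X∣≤1 (b ∷ p) with nonempty? p
  ... | yes (j , j∈p) = inj₁ (j , there j∈p)
  hasLeaf⊎∣X∣≤1 (inside ∷ p)  | no ∅ = inj₂ (s≤s (≤-reflexive (Empty⇒∣p∣≡0 ∅)))
  hasLeaf⊎∣X∣≤1 (outside ∷ p) | no ∅ = inj₂ (≤-trans (≤-reflexive (Empty⇒∣p∣≡0 ∅)) z≤n)

  hasCentreAndLeaf⊎∣X∣≤k : ∀ {k} → 1 ≤ k → (X : Subset (suc k)) → HasCentreAndLeaf X ⊎ ∣ X ∣ ≤ k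
  hasCentreAndLeaf⊎∣X∣≤k 1≤k X with hasLeaf⊎∣X∣≤1 X
  ... | inj₂ ∣X∣≤1 = inj₂ (≤-trans ∣X∣≤1 1≤k)
  hasCentreAndLeaf⊎∣X∣≤k 1≤k (inside ∷ p)  | inj₁ leaf = inj₁ (here , leaf)
  hasCentreAndLeaf⊎∣X∣≤k 1≤k (outside ∷ p) | inj₁ _    = inj₂ (∣p∣≤n p)

module Walks {N : ℕ} (G : Graph N) where

  Pendant : Fin N → Fin N → Set
  Pendant u c = ∀ {w} → G u w → w ≡ c

  pendant-sees-only-support : ∀ {S k u v c} → Pendant u c → c ∈ S →
                              Visible G S k u v → v ≡ u ⊎ v ≡ c
  pendant-sees-only-support p c∈S (_ , nil , _)                  = inj₁ refl
  pendant-sees-only-support p c∈S (_ , cons e nil , _)           = inj₂ (p e)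
  pendant-sees-only-support p c∈S (_ , cons e (cons _ _) , _ , _ , w∉S ∷ _) =
    ⊥-elim (w∉S (subst (_∈ _) (sym (p e)) c∈S))

  pendant-2-visible⇒near : ∀ {S u v c} → Pendant u c → Visible G S 2 u v →
                           v ≡ u ⊎ v ≡ c ⊎ G c v
  pendant-2-visible⇒near p (_ , nil , _)                   = inj₁ refl
  pendant-2-visible⇒near p (_ , cons e nil , _)            = inj₂ (inj₁ (p e))
  pendant-2-visible⇒near {v = v} p (_ , cons e (cons e′ nil) , _) =
    inj₂ (inj₂ (subst (λ w → G w v) (p e) e′))
  pendant-2-visible⇒near p (_ , cons _ (cons _ (cons _ _)) , _ , s≤s (s≤s ()) , _)

  visible-refl : ∀ {S k u} → Visible G S k u u
  visible-refl = 0 , nil , (λ _ _ → z≤n) , z≤n , []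

  shortest₂ : ∀ {u v} → u ≢ v → ¬ G u v → (w : Walk G u v 2) → IsShortest G w
  shortest₂ u≢v ¬uv w _ nil                 = ⊥-elim (u≢v refl)
  shortest₂ u≢v ¬uv w _ (cons e nil)        = ⊥-elim (¬uv e)
  shortest₂ u≢v ¬uv w _ (cons _ (cons _ _)) = s≤s (s≤s z≤n)

  shortest₃ : ∀ {u v} → u ≢ v → ¬ G u v → (∀ {w} → G u w → ¬ G w v) →
              (w : Walk G u v 3) → IsShortest G w
  shortest₃ u≢v ¬uv ¬uwv w _ nil                          = ⊥-elim (u≢v refl)
  shortest₃ u≢v ¬uv ¬uwv w _ (cons e nil)                 = ⊥-elim (¬uv e)
  shortest₃ u≢v ¬uv ¬uwv w _ (cons e (cons e′ nil))       = ⊥-elim (¬uwv e e′)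
  shortest₃ u≢v ¬uv ¬uwv w _ (cons _ (cons _ (cons _ _))) = s≤s (s≤s (s≤s z≤n))

  visible-via : ∀ {S k u c v} → G u c → G c v → ¬ G u v → c ∉ S → 2 ≤ k →
                Visible G S k u v
  visible-via {u = u} {v = v} uc cv ¬uv c∉S 2≤k with u ≟ v
  ... | yes refl = visible-refl
  ... | no u≢v   = 2 , w , shortest₂ u≢v ¬uv w , 2≤k , c∉S ∷ []
    where w = cons uc (cons cv nil)

  visible-via₂ : ∀ {S k u c d v} → G u c → G c d → G d v →
                 ¬ G u v → (∀ {w} → G u w → ¬ G w v) → c ∉ S → d ∉ S → 3 ≤ k →
                 Visible G S k u v
  visible-via₂ {u = u} {v = v} uc cd dv ¬uv ¬uwv c∉S d∉S 3≤k with u ≟ v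
  ... | yes refl = visible-refl
  ... | no u≢v   = 3 , w , shortest₃ u≢v ¬uv ¬uwv w , 3≤k , c∉S ∷ d∉S ∷ []
    where w = cons uc (cons cd (cons dv nil))

module BistarFacts (n m : ℕ) where

  open Subsets
  open Walks (Bistar n m)

  private
    V : Set
    V = Fin (2 + m + n)

  x y : V
  x = zero
  y = suc zero

  xLeaf : Fin m → V
  xLeaf j = suc (suc (j ↑ˡ n))

  yLeaf : Fin n → V
  yLeaf i = suc (suc (m ↑ʳ i))

  data View : V → Set where
    centreˣ : View x
    centreʸ : View y
    leafˣ   : ∀ j → View (xLeaf j)
    leafʸ   : ∀ i → View (yLeaf i)

  view : ∀ v → View v
  view zero          = centreˣ
  view (suc zero)    = centreʸ
  view (suc (suc k)) with Fin.splitAt m k in eq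
  ... | inj₁ j = subst View (cong (suc ∘′ suc) (splitAt⁻¹-↑ˡ eq)) (leafˣ j)
  ... | inj₂ i = subst View (cong (suc ∘′ suc) (splitAt⁻¹-↑ʳ eq)) (leafʸ i)

  xLeaf≢yLeaf : ∀ {j i} → xLeaf j ≢ yLeaf i
  xLeaf≢yLeaf {j} {i} eq with
    trans (sym (splitAt-↑ˡ m j n))
          (trans (cong (Fin.splitAt m) (suc-injective (suc-injective eq))) (splitAt-↑ʳ m n i))
  ... | ()

  bistar-sym : ∀ {u v} → Bistar n m u v → Bistar n m v u
  bistar-sym = swap

  x-y : Bistar n m x y
  x-y = inj₁ (inj₁ (refl , refl))

  x-xLeaf : ∀ j → Bistar n m x (xLeaf j)
  x-xLeaf j = inj₁ (inj₂ (inj₁ (refl , s≤s (s≤s z≤n) , s≤s (s≤s j<m))))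
    where j<m = subst (_< m) (sym (toℕ-↑ˡ j n)) (toℕ<n j)

  y-yLeaf : ∀ i → Bistar n m y (yLeaf i)
  y-yLeaf i = inj₁ (inj₂ (inj₂ (refl , s≤s (s≤s m≤i))))
    where m≤i = subst (m ≤_) (sym (toℕ-↑ʳ m i)) (m≤m+n m (toℕ i))

  xLeaf-pendant : ∀ j → Pendant (xLeaf j) x
  xLeaf-pendant j (inj₁ (inj₁ (() , _)))
  xLeaf-pendant j (inj₁ (inj₂ (inj₁ (() , _))))
  xLeaf-pendant j (inj₁ (inj₂ (inj₂ (() , _))))
  xLeaf-pendant j (inj₂ (inj₁ (_ , ())))
  xLeaf-pendant j (inj₂ (inj₂ (inj₁ (w≡0 , _)))) = toℕ-injective w≡0
  xLeaf-pendant j (inj₂ (inj₂ (inj₂ (_ , m≤j)))) =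
    ⊥-elim (<⇒≱ (toℕ<n j) (subst (m ≤_) (toℕ-↑ˡ j n) (s≤s⁻¹ (s≤s⁻¹ m≤j))))

  yLeaf-pendant : ∀ i → Pendant (yLeaf i) y
  yLeaf-pendant i (inj₁ (inj₁ (() , _)))
  yLeaf-pendant i (inj₁ (inj₂ (inj₁ (() , _))))
  yLeaf-pendant i (inj₁ (inj₂ (inj₂ (() , _))))
  yLeaf-pendant i (inj₂ (inj₁ (_ , ())))
  yLeaf-pendant i (inj₂ (inj₂ (inj₁ (_ , _ , i<m)))) =
    ⊥-elim (<⇒≱ (subst (_< m) (toℕ-↑ʳ m i) (s≤s⁻¹ (s≤s⁻¹ i<m))) (m≤m+n m (toℕ i)))
  yLeaf-pendant i (inj₂ (inj₂ (inj₂ (w≡1 , _)))) = toℕ-injective w≡1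

  ¬x-yLeaf : ∀ {i} → ¬ Bistar n m x (yLeaf i)
  ¬x-yLeaf {i} e with yLeaf-pendant i (bistar-sym e)
  ... | ()

  ¬y-xLeaf : ∀ {j} → ¬ Bistar n m y (xLeaf j)
  ¬y-xLeaf {j} e with xLeaf-pendant j (bistar-sym e)
  ... | ()

  join : Subset (suc m) → Subset (suc n) → Subset (2 + m + n)
  join (b ∷ X) (b′ ∷ Y) = b ∷ b′ ∷ X ++ Y

  join-surjective : ∀ S → ∃₂ λ X Y → join X Y ≡ S
  join-surjective (b ∷ b′ ∷ r) =
    b ∷ take m r , b′ ∷ drop m r , cong (λ r → b ∷ b′ ∷ r) (take++drop≡id m r)

  ∣join∣ : ∀ X Y → ∣ join X Y ∣ ≡ ∣ X ∣ + ∣ Y ∣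
  ∣join∣ (inside  ∷ X) (inside  ∷ Y) = cong suc (trans (cong suc (∣p++q∣≡∣p∣+∣q∣ X Y)) (sym (+-suc ∣ X ∣ ∣ Y ∣)))
  ∣join∣ (inside  ∷ X) (outside ∷ Y) = cong suc (∣p++q∣≡∣p∣+∣q∣ X Y)
  ∣join∣ (outside ∷ X) (inside  ∷ Y) = trans (cong suc (∣p++q∣≡∣p∣+∣q∣ X Y)) (sym (+-suc ∣ X ∣ ∣ Y ∣))
  ∣join∣ (outside ∷ X) (outside ∷ Y) = ∣p++q∣≡∣p∣+∣q∣ X Y

  xVertex : Fin (suc m) → V
  xVertex zero    = x
  xVertex (suc j) = xLeaf j

  yVertex : Fin (suc n) → V
  yVertex zero    = y
  yVertex (suc i) = yLeaf i

  xVertex∈join : ∀ {X Y i} → i ∈ X → xVertex i ∈ join X Y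
  xVertex∈join {_ ∷ _} {_ ∷ Y} here          = here
  xVertex∈join {_ ∷ _} {_ ∷ Y} (there j∈X)   = there (there (∈-++⁺ˡ Y j∈X))

  yVertex∈join : ∀ {X Y i} → i ∈ Y → yVertex i ∈ join X Y
  yVertex∈join {_ ∷ X} {_ ∷ _} here          = there here
  yVertex∈join {_ ∷ X} {_ ∷ _} (there i∈Y)   = there (there (∈-++⁺ʳ X i∈Y))

  yLeaf∈join⁻ : ∀ {X Y i} → yLeaf i ∈ join X Y → suc i ∈ Y
  yLeaf∈join⁻ {_ ∷ X} {_ ∷ _} (there (there i∈X++Y)) = there (∈-++⁻ʳ X i∈X++Y)

  yVertex≢x : ∀ i → yVertex i ≢ x
  yVertex≢x zero    ()
  yVertex≢x (suc i) ()

  yVertex≢xLeaf : ∀ i {j} → yVertex i ≢ xLeaf j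
  yVertex≢xLeaf zero    ()
  yVertex≢xLeaf (suc i) = xLeaf≢yLeaf ∘′ sym

  xVertex≢y : ∀ j → xVertex j ≢ y
  xVertex≢y zero    ()
  xVertex≢y (suc j) ()

  xVertex≢yLeaf : ∀ j {i} → xVertex j ≢ yLeaf i
  xVertex≢yLeaf zero    ()
  xVertex≢yLeaf (suc j) = xLeaf≢yLeaf

  centreAndLeaf-blocks-y : ∀ {k X Y} → HasCentreAndLeaf X →
                           IsKDMV (Bistar n m) k (join X Y) → ∣ Y ∣ ≡ 0
  centreAndLeaf-blocks-y (x∈X , j , j∈X) D = Empty⇒∣p∣≡0 λ (i , i∈Y) →
    [ yVertex≢xLeaf i , yVertex≢x i ]′
      (pendant-sees-only-support (xLeaf-pendant j) (xVertex∈join x∈X)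
        (D _ _ (xVertex∈join j∈X) (yVertex∈join i∈Y)))

  centreAndLeaf-blocks-x : ∀ {k X Y} → HasCentreAndLeaf Y →
                           IsKDMV (Bistar n m) k (join X Y) → ∣ X ∣ ≡ 0
  centreAndLeaf-blocks-x (y∈Y , i , i∈Y) D = Empty⇒∣p∣≡0 λ (j , j∈X) →
    [ xVertex≢yLeaf j , xVertex≢y j ]′
      (pendant-sees-only-support (yLeaf-pendant i) (yVertex∈join y∈Y)
        (D _ _ (yVertex∈join i∈Y) (xVertex∈join j∈X)))

  leaves-not-2-visible : ∀ {X Y} → HasLeaf X → HasLeaf Y → ¬ IsKDMV (Bistar n m) 2 (join X Y)
  leaves-not-2-visible (j , j∈X) (i , i∈Y) D
    with pendant-2-visible⇒near (xLeaf-pendant j) (D _ _ (xVertex∈join j∈X) (yVertex∈join i∈Y))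
  ... | inj₁ yLeaf≡xLeaf  = xLeaf≢yLeaf (sym yLeaf≡xLeaf)
  ... | inj₂ (inj₁ ())
  ... | inj₂ (inj₂ x-yLeaf) = ¬x-yLeaf x-yLeaf

  x-side-bound : ∀ {k X Y} → 1 ≤ m → IsKDMV (Bistar n m) k (join X Y) →
                 ∣ X ∣ ≤ m ⊎ ∣ join X Y ∣ ≤ suc m
  x-side-bound {X = X} {Y} 1≤m D with hasCentreAndLeaf⊎∣X∣≤k 1≤m X
  ... | inj₂ ∣X∣≤m = inj₁ ∣X∣≤m
  ... | inj₁ c     = inj₂ (begin
    ∣ join X Y ∣   ≡⟨ ∣join∣ X Y ⟩
    ∣ X ∣ + ∣ Y ∣  ≡⟨ cong (∣ X ∣ +_) (centreAndLeaf-blocks-y c D) ⟩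
    ∣ X ∣ + 0      ≡⟨ +-identityʳ ∣ X ∣ ⟩
    ∣ X ∣          ≤⟨ ∣p∣≤n X ⟩
    suc m          ∎)
    where open ≤-Reasoning

  y-side-bound : ∀ {k X Y} → 1 ≤ n → IsKDMV (Bistar n m) k (join X Y) →
                 ∣ Y ∣ ≤ n ⊎ ∣ join X Y ∣ ≤ suc n
  y-side-bound {X = X} {Y} 1≤n D with hasCentreAndLeaf⊎∣X∣≤k 1≤n Y
  ... | inj₂ ∣Y∣≤n = inj₁ ∣Y∣≤n
  ... | inj₁ c     = inj₂ (begin
    ∣ join X Y ∣   ≡⟨ ∣join∣ X Y ⟩
    ∣ X ∣ + ∣ Y ∣  ≡⟨ cong (_+ ∣ Y ∣) (centreAndLeaf-blocks-x c D) ⟩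
    ∣ Y ∣          ≤⟨ ∣p∣≤n Y ⟩
    suc n          ∎)
    where open ≤-Reasoning

  kdmv⇒∣S∣≤n+m : ∀ {k} → 1 ≤ n → 1 ≤ m → ∀ S → IsKDMV (Bistar n m) k S → ∣ S ∣ ≤ n + m
  kdmv⇒∣S∣≤n+m 1≤n 1≤m S D with join-surjective S
  ... | X , Y , refl with x-side-bound 1≤m D | y-side-bound 1≤n D
  ...   | inj₂ ∣S∣≤1+m | _            = ≤-trans ∣S∣≤1+m (+-monoˡ-≤ m 1≤n)
  ...   | _            | inj₂ ∣S∣≤1+n = ≤-trans ∣S∣≤1+n (≤-trans (+-monoˡ-≤ n 1≤m) (≤-reflexive (+-comm m n)))
  ...   | inj₁ ∣X∣≤m   | inj₁ ∣Y∣≤n   = begin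
    ∣ join X Y ∣   ≡⟨ ∣join∣ X Y ⟩
    ∣ X ∣ + ∣ Y ∣  ≤⟨ +-mono-≤ ∣X∣≤m ∣Y∣≤n ⟩
    m + n          ≡⟨ +-comm m n ⟩
    n + m          ∎
    where open ≤-Reasoning

  2dmv⇒∣S∣≤m+1 : 1 ≤ n → n ≤ m → ∀ S → IsKDMV (Bistar n m) 2 S → ∣ S ∣ ≤ m + 1
  2dmv⇒∣S∣≤m+1 1≤n n≤m S D with join-surjective S
  ... | X , Y , refl = subst (∣ join X Y ∣ ≤_) (+-comm 1 m) ∣S∣≤1+m
    where
    1≤m = ≤-trans 1≤n n≤m

    ∣S∣≤ : ∀ {a b} → ∣ X ∣ ≤ a → ∣ Y ∣ ≤ b → a + b ≤ 1 + m → ∣ join X Y ∣ ≤ 1 + m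
    ∣S∣≤ ∣X∣≤a ∣Y∣≤b a+b≤1+m = ≤-trans (≤-reflexive (∣join∣ X Y)) (≤-trans (+-mono-≤ ∣X∣≤a ∣Y∣≤b) a+b≤1+m)

    ∣S∣≤1+m : ∣ join X Y ∣ ≤ 1 + m
    ∣S∣≤1+m with hasLeaf⊎∣X∣≤1 X | hasLeaf⊎∣X∣≤1 Y
    ... | inj₁ X-leaf | inj₁ Y-leaf = ⊥-elim (leaves-not-2-visible X-leaf Y-leaf D)
    ... | inj₁ _      | inj₂ ∣Y∣≤1  =
      [ (λ ∣X∣≤m → ∣S∣≤ ∣X∣≤m ∣Y∣≤1 (≤-reflexive (+-comm m 1))) , id ]′ (x-side-bound 1≤m D)
    ... | inj₂ ∣X∣≤1  | inj₁ _      =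
      [ (λ ∣Y∣≤n → ∣S∣≤ ∣X∣≤1 ∣Y∣≤n (s≤s n≤m)) , (λ ∣S∣≤1+n → ≤-trans ∣S∣≤1+n (s≤s n≤m)) ]′ (y-side-bound 1≤n D)
    ... | inj₂ ∣X∣≤1  | inj₂ ∣Y∣≤1  = ∣S∣≤ ∣X∣≤1 ∣Y∣≤1 (s≤s 1≤m)

  xLeaf-xLeaf-visible : ∀ {S k j j′} → x ∉ S → 2 ≤ k → Visible (Bistar n m) S k (xLeaf j) (xLeaf j′)
  xLeaf-xLeaf-visible {j = j} {j′} =
    visible-via (bistar-sym (x-xLeaf j)) (x-xLeaf j′) λ e → case xLeaf-pendant j e of λ ()

  yLeaf-yLeaf-visible : ∀ {S k i i′} → y ∉ S → 2 ≤ k → Visible (Bistar n m) S k (yLeaf i) (yLeaf i′)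
  yLeaf-yLeaf-visible {i = i} {i′} =
    visible-via (bistar-sym (y-yLeaf i)) (y-yLeaf i′) λ e → case yLeaf-pendant i e of λ ()

  y-xLeaf-visible : ∀ {S k j} → x ∉ S → 2 ≤ k → Visible (Bistar n m) S k y (xLeaf j)
  y-xLeaf-visible {j = j} = visible-via (bistar-sym x-y) (x-xLeaf j) ¬y-xLeaf

  xLeaf-y-visible : ∀ {S k j} → x ∉ S → 2 ≤ k → Visible (Bistar n m) S k (xLeaf j) y
  xLeaf-y-visible {j = j} = visible-via (bistar-sym (x-xLeaf j)) x-y (¬y-xLeaf ∘′ bistar-sym)

  xLeaf-yLeaf-visible : ∀ {S k j i} → x ∉ S → y ∉ S → 3 ≤ k →
                        Visible (Bistar n m) S k (xLeaf j) (yLeaf i)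
  xLeaf-yLeaf-visible {j = j} {i} =
    visible-via₂ (bistar-sym (x-xLeaf j)) x-y (y-yLeaf i)
      (λ e → case xLeaf-pendant j e of λ ())
      (λ e → subst (λ w → ¬ Bistar n m w (yLeaf i)) (sym (xLeaf-pendant j e)) ¬x-yLeaf)

  yLeaf-xLeaf-visible : ∀ {S k j i} → x ∉ S → y ∉ S → 3 ≤ k →
                        Visible (Bistar n m) S k (yLeaf i) (xLeaf j)
  yLeaf-xLeaf-visible {j = j} {i} x∉S y∉S =
    visible-via₂ (bistar-sym (y-yLeaf i)) (bistar-sym x-y) (x-xLeaf j)
      (λ e → case yLeaf-pendant i e of λ ())
      (λ e → subst (λ w → ¬ Bistar n m w (xLeaf j)) (sym (yLeaf-pendant i e)) ¬y-xLeaf)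
      y∉S x∉S

  leaves : Subset (2 + m + n)
  leaves = join (outside ∷ ⊤) (outside ∷ ⊤)

  ∣leaves∣ : ∣ leaves ∣ ≡ n + m
  ∣leaves∣ = trans (∣join∣ (outside ∷ ⊤) (outside ∷ ⊤)) (trans (cong₂ _+_ (∣⊤∣≡n m) (∣⊤∣≡n n)) (+-comm m n))

  leaves-kdmv : ∀ {k} → 3 ≤ k → IsKDMV (Bistar n m) k leaves
  leaves-kdmv 3≤k u v u∈S v∈S with view u | view v
  ... | centreˣ | _ with () ← u∈S
  ... | centreʸ | _ with there () ← u∈S
  ... | _ | centreˣ with () ← v∈S
  ... | _ | centreʸ with there () ← v∈S
  ... | leafˣ j | leafˣ j′ = xLeaf-xLeaf-visible (λ ()) (≤-trans (n≤1+n 2) 3≤k)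
  ... | leafˣ j | leafʸ i  = xLeaf-yLeaf-visible (λ ()) (λ { (there ()) }) 3≤k
  ... | leafʸ i | leafˣ j  = yLeaf-xLeaf-visible (λ ()) (λ { (there ()) }) 3≤k
  ... | leafʸ i | leafʸ i′ = yLeaf-yLeaf-visible (λ { (there ()) }) (≤-trans (n≤1+n 2) 3≤k)

  xLeavesAndY : Subset (2 + m + n)
  xLeavesAndY = join (outside ∷ ⊤) (inside ∷ ⊥)

  ∣xLeavesAndY∣ : ∣ xLeavesAndY ∣ ≡ m + 1
  ∣xLeavesAndY∣ = trans (∣join∣ (outside ∷ ⊤) (inside ∷ ⊥)) (cong₂ (λ a b → a + suc b) (∣⊤∣≡n m) (∣⊥∣≡0 n))

  xLeavesAndY-kdmv : ∀ {k} → 2 ≤ k → IsKDMV (Bistar n m) k xLeavesAndY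
  xLeavesAndY-kdmv 2≤k u v u∈S v∈S with view u | view v
  ... | centreˣ | _ with () ← u∈S
  ... | _ | centreˣ with () ← v∈S
  ... | leafʸ i | _ = ⊥-elim (∉⊥ (drop-there (yLeaf∈join⁻ u∈S)))
  ... | _ | leafʸ i = ⊥-elim (∉⊥ (drop-there (yLeaf∈join⁻ v∈S)))
  ... | centreʸ | centreʸ  = visible-refl
  ... | centreʸ | leafˣ j  = y-xLeaf-visible (λ ()) 2≤k
  ... | leafˣ j | centreʸ  = xLeaf-y-visible (λ ()) 2≤k
  ... | leafˣ j | leafˣ j′ = xLeaf-xLeaf-visible (λ ()) 2≤k

proposition4p2 : (n m : ℕ) → 1 ≤ n → n ≤ m →
    IsMu (Bistar n m) 2 (m + 1) × IsMu (Bistar n m) 3 (n + m)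
proposition4p2 n m 1≤n n≤m =
    ((xLeavesAndY , xLeavesAndY-kdmv ≤-refl , ∣xLeavesAndY∣) , 2dmv⇒∣S∣≤m+1 1≤n n≤m)
  , ((leaves , leaves-kdmv ≤-refl , ∣leaves∣) , kdmv⇒∣S∣≤n+m 1≤n (≤-trans 1≤n n≤m))
  where open BistarFacts n m
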